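{- Let $G=(C\cup I,E)$ be a connected split graph, where $C$ induces an inclusion-maximal clique and $I$ induces an independent set. Then $h(G)=|C|$ if and only if for every two distinct vertices $x,y\in C$ there exists a vertex $z\in I$ adjacent to both $x$ and $y$. Otherwise, $h(G)=|C|-1$.
   Context: Hunters and Rabbit game on a graph $G=(V,E)$. A hunter strategy is a finite sequence $(S_1,\dots,S_\ell)$ of non-empty subsets of $V$, using $\max_i|S_i|$ hunters. A rabbit trajectory is a walk $(r_0,\dots,r_\ell)$ in $G$ ($r_i\in N(r_{i-1})$); the strategy is winning if every rabbit trajectory has some $j<\ell$ with $r_j\in S_{j+1}$. The hunter number $h(G)$ is the minimum number of hunters of a winning hunter strategy ($0$ for a single-vertex graph). -}

module Defs where

open import Data.Nat using (ℕ; zero; suc; _≤_; _∸_)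
open import Data.Fin using (Fin; inject₁) renaming (suc to fsuc)
open import Data.Fin.Subset using (Subset; _∈_; _∉_; _⊆_; ∣_∣; Nonempty)
open import Data.Bool using (Bool; true; false)
open import Data.Product using (Σ; ∃; _×_)
open import Data.Sum using (_⊎_)
open import Relation.Binary.PropositionalEquality using (_≡_; _≢_)
open import Relation.Nullary using (¬_)

record Graph (n : ℕ) : Set where
  field
    adj    : Fin n → Fin n → Bool
    sym    : ∀ u v → adj u v ≡ adj v u
    irrefl : ∀ v → adj v v ≡ false

module _ {n : ℕ} (G : Graph n) where
  open Graph G

  Adj : Fin n → Fin n → Set
  Adj u v = adj u v ≡ true

  data Reach : Fin n → Fin n → Set where
    here : ∀ {u} → Reach u u
    step : ∀ {u v w} → Adj u v → Reach v w → Reach u w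

  Connected : Set
  Connected = ∀ u v → Reach u v

  IsClique : Subset n → Set
  IsClique C = ∀ x y → x ∈ C → y ∈ C → x ≢ y → Adj x y

  IsIndependent : Subset n → Set
  IsIndependent S = ∀ x y → x ∈ S → y ∈ S → ¬ Adj x y

  IsMaximalClique : Subset n → Set
  IsMaximalClique C = IsClique C × (∀ D → IsClique D → C ⊆ D → D ⊆ C)

  -- a hunter strategy of length ℓ: S j is the set S_{j+1} (0-indexed), nonempty
  Strategy : ℕ → Set
  Strategy ℓ = Fin ℓ → Subset n

  ValidStrategy : ∀ {ℓ} → Strategy ℓ → Set
  ValidStrategy S = ∀ j → Nonempty (S j)

  IsTrajectory : ∀ ℓ → (Fin (suc ℓ) → Fin n) → Set
  IsTrajectory ℓ r = ∀ (i : Fin ℓ) → Adj (r (inject₁ i)) (r (fsuc i))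

  Winning : ∀ {ℓ} → Strategy ℓ → Set
  Winning {ℓ} S = ∀ r → IsTrajectory ℓ r → ∃ λ (j : Fin ℓ) → r (inject₁ j) ∈ S j

  UsesAtMost : ∀ {ℓ} → Strategy ℓ → ℕ → Set
  UsesAtMost S k = ∀ j → ∣ S j ∣ ≤ k

  WinnableWith : ℕ → Set
  WinnableWith k = ∃ λ ℓ → Σ (Strategy ℓ) λ S → ValidStrategy S × Winning S × UsesAtMost S k

  IsHunterNumber : ℕ → Set
  IsHunterNumber k = (n ≡ 1 × k ≡ 0) ⊎ (n ≢ 1 × WinnableWith k × (∀ m → WinnableWith m → k ≤ m))

-- Upper bounds: since I is independent, hunting all of C twice catches every rabbit. If
-- x, y ∈ C have no common neighbour in I, the rounds C - y, C - y, C - x, C - x, C - y do: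
-- a dodging rabbit may only use I and the one unhunted vertex of C, never stays in I for two
-- rounds and never stays put, so following the unhunted vertex from y to x and back to y
-- forces it through a vertex of I adjacent to both.
-- Lower bounds: the rabbit stays in C. Against |C| - 2 hunters two vertices of C are free in
-- every round, so it can always move to a free one. Against |C| - 1 hunters, if the next
-- round leaves no other vertex of C free, it leaves exactly C minus the rabbit's vertex
-- hunted, so the rabbit detours through a common neighbour in I of its vertex and a vertex
-- of C free in the round after.

module Submission where

open import Defs
open import Data.Nat using (ℕ; _<_; _∸_)
open import Data.Fin using (Fin)
open import Data.Fin.Subset using (Subset; _∈_; _∉_; ∣_∣; ∁)
open import Data.Product using (∃; _×_)
open import Relation.Binary.PropositionalEquality using (_≢_)
open import Relation.Nullary using (¬_)
open import Function.Bundles using (_⇔_)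

open import Data.Nat using (zero; suc; _≤_; _+_; z≤n; s≤s; >-nonZero)
open import Data.Nat.Properties
  using (_≤?_; ≤-refl; ≤-reflexive; ≤-trans; ≤-<-trans; <⇒≱; ≰⇒>; n≮n; n≤1+n; +-suc; +-comm;
         +-monoʳ-≤; <⇒≤pred; pred-cancel-<; m≤pred[n]⇒suc[m]≤n; module ≤-Reasoning)
open import Data.Fin using (zero; suc; inject₁) renaming (_≟_ to _≟ᶠ_)
open import Data.Fin.Subset using (_∪_; _-_; ⁅_⁆; Nonempty; _⊆_) renaming (⊥ to ∅)
open import Data.Fin.Subset.Properties
  using (_∈?_; nonempty?; ∣p∣≤∣x∷p∣; ∣⊥∣≡0; ∣⁅x⁆∣≡1; p⊆q⇒∣p∣≤∣q∣; p⊆p∪q; q⊆p∪q; x∈⁅x⁆; x∈⁅y⁆⇒x≡y;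
         x∈p⇒∣p-x∣<∣p∣; x∈p∧x≢y⇒x∈p-y; x∉p⇒x∈∁p)
open import Data.Fin.Properties using (any?)
open import Data.Vec using ([]; _∷_)
open import Data.Vec.Functional using (head; tail)
open import Data.Bool using (true; false) renaming (_≟_ to _≟ᵇ_)
open import Data.Product using (_,_; proj₁; proj₂)
open import Data.Sum using (_⊎_; inj₁; inj₂; map₂)
open import Data.Empty using (⊥; ⊥-elim)
open import Relation.Binary.PropositionalEquality
  using (_≡_; refl; sym; trans; cong; subst; subst₂)
open import Relation.Nullary using (Dec; yes; no; contradiction; ¬?)
open import Relation.Nullary.Decidable using (_×-dec_; decidable-stable)
open import Function using (_∘_)
open import Function.Bundles using (mk⇔)

∣p∪q∣≤∣p∣+∣q∣ : ∀ {n} (p q : Subset n) → ∣ p ∪ q ∣ ≤ ∣ p ∣ + ∣ q ∣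
∣p∪q∣≤∣p∣+∣q∣ []          []          = z≤n
∣p∪q∣≤∣p∣+∣q∣ (true ∷ p)  (s ∷ q)     =
  s≤s (≤-trans (∣p∪q∣≤∣p∣+∣q∣ p q) (+-monoʳ-≤ ∣ p ∣ (∣p∣≤∣x∷p∣ s q)))
∣p∪q∣≤∣p∣+∣q∣ (false ∷ p) (true ∷ q)  =
  ≤-trans (s≤s (∣p∪q∣≤∣p∣+∣q∣ p q)) (≤-reflexive (sym (+-suc ∣ p ∣ ∣ q ∣)))
∣p∪q∣≤∣p∣+∣q∣ (false ∷ p) (false ∷ q) = ∣p∪q∣≤∣p∣+∣q∣ p q

x∈p⇒0<∣p∣ : ∀ {n} {p : Subset n} {x} → x ∈ p → 0 < ∣ p ∣
x∈p⇒0<∣p∣ x∈p = ≤-trans (s≤s z≤n) (x∈p⇒∣p-x∣<∣p∣ x∈p)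

∣p∣<∣q∣⇒∃∈q∉p : ∀ {n} {p q : Subset n} → ∣ p ∣ < ∣ q ∣ → ∃ λ x → x ∈ q × x ∉ p
∣p∣<∣q∣⇒∃∈q∉p {p = p} {q} ∣p∣<∣q∣ with any? (λ x → (x ∈? q) ×-dec ¬? (x ∈? p))
... | yes found = found
... | no none   = contradiction (p⊆q⇒∣p∣≤∣q∣ q⊆p) (<⇒≱ ∣p∣<∣q∣)
  where
  q⊆p : q ⊆ p
  q⊆p {x} x∈q = decidable-stable (x ∈? p) (λ x∉p → none (x , x∈q , x∉p))

1+∣p∣<∣q∣⇒∃∈q∉p≢ : ∀ {n} {p q : Subset n} → suc ∣ p ∣ < ∣ q ∣ → ∀ y → ∃ λ x → x ∈ q × x ∉ p × x ≢ y
1+∣p∣<∣q∣⇒∃∈q∉p≢ {p = p} {q} 1+∣p∣<∣q∣ y =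
  let x , x∈q , x∉p∪y = ∣p∣<∣q∣⇒∃∈q∉p {p = p ∪ ⁅ y ⁆} ∣p∪y∣<∣q∣
  in  x , x∈q , x∉p∪y ∘ p⊆p∪q ⁅ y ⁆ ,
      λ x≡y → x∉p∪y (q⊆p∪q p ⁅ y ⁆ (subst (_∈ ⁅ y ⁆) (sym x≡y) (x∈⁅x⁆ y)))
  where
  ∣p∪y∣<∣q∣ : ∣ p ∪ ⁅ y ⁆ ∣ < ∣ q ∣
  ∣p∪y∣<∣q∣ = begin-strict
    ∣ p ∪ ⁅ y ⁆ ∣     ≤⟨ ∣p∪q∣≤∣p∣+∣q∣ p ⁅ y ⁆ ⟩
    ∣ p ∣ + ∣ ⁅ y ⁆ ∣ ≡⟨ cong (∣ p ∣ +_) (∣⁅x⁆∣≡1 y) ⟩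
    ∣ p ∣ + 1         ≡⟨ +-comm ∣ p ∣ 1 ⟩
    suc ∣ p ∣         <⟨ 1+∣p∣<∣q∣ ⟩
    ∣ q ∣             ∎
    where open ≤-Reasoning

0<∣p∣⇒nonempty : ∀ {n} {p : Subset n} → 0 < ∣ p ∣ → Nonempty p
0<∣p∣⇒nonempty {n} {p} 0<∣p∣ =
  let x , x∈p , _ = ∣p∣<∣q∣⇒∃∈q∉p {p = ∅} (subst (_< ∣ p ∣) (sym (∣⊥∣≡0 n)) 0<∣p∣) in x , x∈p

1<∣p∣⇒∃∈p≢ : ∀ {n} {p : Subset n} → 1 < ∣ p ∣ → ∀ y → ∃ λ x → x ∈ p × x ≢ y
1<∣p∣⇒∃∈p≢ {n} {p} 1<∣p∣ y =
  let x , x∈p , _ , x≢y =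
        1+∣p∣<∣q∣⇒∃∈q∉p≢ {p = ∅} (subst (λ k → suc k < ∣ p ∣) (sym (∣⊥∣≡0 n)) 1<∣p∣) y
  in  x , x∈p , x≢y

x∉p-y⇒x≡y⊎x∉p : ∀ {n} {p : Subset n} {x y} → x ∉ p - y → x ≡ y ⊎ x ∉ p
x∉p-y⇒x≡y⊎x∉p {x = x} {y} x∉p-y with x ≟ᶠ y
... | yes x≡y = inj₁ x≡y
... | no  x≢y = inj₂ (λ x∈p → x∉p-y (x∈p∧x≢y⇒x∈p-y x∈p x≢y))

module _ {n : ℕ} (G : Graph n) where

  Adj-sym : ∀ {u v} → Adj G u v → Adj G v u
  Adj-sym {u} {v} u~v = trans (Graph.sym G v u) u~v

  Adj-irrefl : ∀ {u} → ¬ Adj G u u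
  Adj-irrefl {u} u~u with () ← trans (sym u~u) (Graph.irrefl G u)

  Adj? : ∀ u v → Dec (Adj G u v)
  Adj? u v = Graph.adj G u v ≟ᵇ true

  Avoids : ∀ {ℓ} → Strategy G ℓ → (Fin (suc ℓ) → Fin n) → Set
  Avoids S r = ∀ j → r (inject₁ j) ∉ S j

  Escapes : ∀ {ℓ} → Strategy G ℓ → Fin n → Set
  Escapes {ℓ} S v = ∃ λ r → r zero ≡ v × IsTrajectory G ℓ r × Avoids S r

  escapes-[] : (S : Strategy G 0) (v : Fin n) → Escapes S v
  escapes-[] S v = (λ _ → v) , refl , (λ ()) , (λ ())

  escapes-∷ : ∀ {ℓ} (S : Strategy G (suc ℓ)) {v w} →
              v ∉ head S → Adj G v w → Escapes (tail S) w → Escapes S v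
  escapes-∷ {ℓ} S {v} v∉S₀ v~w (r , refl , walk , avoids) = v∷r , refl , walk′ , avoids′
    where
    v∷r : Fin (suc (suc ℓ)) → Fin n
    v∷r zero    = v
    v∷r (suc i) = r i
    walk′ : IsTrajectory G (suc ℓ) v∷r
    walk′ zero    = v~w
    walk′ (suc i) = walk i
    avoids′ : Avoids S v∷r
    avoids′ zero    = v∉S₀
    avoids′ (suc j) = avoids j

  escapes⇒¬winning : ∀ {ℓ} (S : Strategy G ℓ) {v} → Escapes S v → ¬ Winning G S
  escapes⇒¬winning S (r , _ , walk , avoids) winning =
    let j , caught = winning r walk in avoids j caught

  unavoidable⇒winning : ∀ {ℓ} (S : Strategy G ℓ) →
                        (∀ r → IsTrajectory G ℓ r → ¬ Avoids S r) → Winning G S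
  unavoidable⇒winning S unavoidable r walk with any? (λ j → r (inject₁ j) ∈? S j)
  ... | yes caught  = caught
  ... | no  escaped = contradiction (λ j r∈Sⱼ → escaped (j , r∈Sⱼ)) (unavoidable r walk)

  winnable⇒0<hunters : ∀ {m} → Fin n → WinnableWith G m → 0 < m
  winnable⇒0<hunters v (zero , S , _ , winning , _) =
    contradiction winning (escapes⇒¬winning S (escapes-[] S v))
  winnable⇒0<hunters v (suc ℓ , S , nonempty , _ , uses) =
    let x , x∈S₀ = nonempty zero in ≤-trans (x∈p⇒0<∣p∣ x∈S₀) (uses zero)

  isHunterNumber : ∀ {k} → n ≢ 1 → WinnableWith G k →
                   (∀ m → m < k → ¬ WinnableWith G m) → IsHunterNumber G k
  isHunterNumber {k} n≢1 winnable hopeless = inj₂ (n≢1 , winnable , minimal)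
    where
    minimal : ∀ m → WinnableWith G m → k ≤ m
    minimal m winnableₘ = decidable-stable (k ≤? m) (λ k≰m → hopeless m (≰⇒> k≰m) winnableₘ)

  firstRound : ∀ {ℓ} → Strategy G ℓ → Subset n
  firstRound {zero}  S = ∅
  firstRound {suc ℓ} S = head S

  ∣firstRound∣≤ : ∀ {ℓ m} (S : Strategy G ℓ) → UsesAtMost G S m → ∣ firstRound S ∣ ≤ m
  ∣firstRound∣≤ {zero}  S uses = ≤-trans (≤-reflexive (∣⊥∣≡0 n)) z≤n
  ∣firstRound∣≤ {suc ℓ} S uses = uses zero

  SafeIn : Subset n → ∀ {ℓ} → Strategy G ℓ → Set
  SafeIn C S = ∀ v → v ∈ C → v ∉ firstRound S → Escapes S v

  safe⇒¬winning : ∀ {C ℓ m} (S : Strategy G ℓ) → UsesAtMost G S m → m < ∣ C ∣ →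
                  SafeIn C S → ¬ Winning G S
  safe⇒¬winning S uses m<∣C∣ safe =
    let v , v∈C , v∉S₀ = ∣p∣<∣q∣⇒∃∈q∉p (≤-<-trans (∣firstRound∣≤ S uses) m<∣C∣)
    in  escapes⇒¬winning S (safe v v∈C v∉S₀)

  module _ {C : Subset n} (clique : IsClique G C) where

    clique-safe : ∀ {m} → suc m < ∣ C ∣ → ∀ {ℓ} (S : Strategy G ℓ) → UsesAtMost G S m → SafeIn C S
    clique-safe m+1<∣C∣ {zero}  S uses v _ _ = escapes-[] S v
    clique-safe m+1<∣C∣ {suc ℓ} S uses v v∈C v∉S₀ =
      let w , w∈C , w∉S₁ , w≢v =
            1+∣p∣<∣q∣⇒∃∈q∉p≢ (≤-<-trans (s≤s (∣firstRound∣≤ (tail S) (λ j → uses (suc j)))) m+1<∣C∣) v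
      in  escapes-∷ S v∉S₀ (clique v w v∈C w∈C (w≢v ∘ sym))
                    (clique-safe m+1<∣C∣ (tail S) (λ j → uses (suc j)) w w∈C w∉S₁)

    clique-¬winnable : ∀ {m} → suc m < ∣ C ∣ → ¬ WinnableWith G m
    clique-¬winnable {m} m+1<∣C∣ (ℓ , S , _ , winning , uses) =
      safe⇒¬winning S uses (≤-trans (s≤s (n≤1+n m)) m+1<∣C∣) (clique-safe m+1<∣C∣ S uses) winning

  OutsideCommonNeighbour : Subset n → Fin n → Fin n → Set
  OutsideCommonNeighbour C x y = ∃ λ z → z ∉ C × Adj G z x × Adj G z y

  PairwiseOutsideCommonNeighbours : Subset n → Set
  PairwiseOutsideCommonNeighbours C =
    ∀ x y → x ∈ C → y ∈ C → x ≢ y → OutsideCommonNeighbour C x y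

  outsideCommonNeighbour? : ∀ C x y → Dec (OutsideCommonNeighbour C x y)
  outsideCommonNeighbour? C x y = any? λ z → ¬? (z ∈? C) ×-dec Adj? z x ×-dec Adj? z y

  module _ {C : Subset n} (clique : IsClique G C) (pairwise : PairwiseOutsideCommonNeighbours C) where

    outsideCommonNeighbour : 1 < ∣ C ∣ → ∀ {v w} → v ∈ C → w ∈ C → OutsideCommonNeighbour C v w
    outsideCommonNeighbour 1<∣C∣ {v} {w} v∈C w∈C with w ≟ᶠ v
    ... | no  w≢v  = pairwise v w v∈C w∈C (w≢v ∘ sym)
    ... | yes refl =
      let u , u∈C , u≢v   = 1<∣p∣⇒∃∈p≢ 1<∣C∣ v
          z , z∉C , z~v , _ = pairwise v u v∈C u∈C (u≢v ∘ sym)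
      in  z , z∉C , z~v , z~v

    module _ {m} (m<∣C∣ : m < ∣ C ∣) (1<∣C∣ : 1 < ∣ C ∣) where

      safe-∷∷ : ∀ {ℓ} (S : Strategy G (suc (suc ℓ))) → UsesAtMost G S m →
                SafeIn C (tail S) → SafeIn C (tail (tail S)) → SafeIn C S
      safe-∷∷ S uses safe₁ safe₂ v v∈C v∉S₀ =
        let w , w∈C , w∉S₂ =
              ∣p∣<∣q∣⇒∃∈q∉p (≤-<-trans (∣firstRound∣≤ S₂ (λ j → uses (suc (suc j)))) m<∣C∣)
        in  via w w∈C w∉S₂ (outsideCommonNeighbour 1<∣C∣ v∈C w∈C)
        where
        S₁ = head (tail S)
        S₂ = tail (tail S)
        via : ∀ w → w ∈ C → w ∉ firstRound S₂ → OutsideCommonNeighbour C v w → Escapes S v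
        via w w∈C w∉S₂ (z , z∉C , z~v , z~w) with z ∈? S₁
        ... | no z∉S₁ =
          escapes-∷ S v∉S₀ (Adj-sym z~v) (escapes-∷ (tail S) z∉S₁ z~w (safe₂ w w∈C w∉S₂))
        -- Hunting z costs the second round one vertex of C, so another vertex of C is free.
        ... | yes z∈S₁ =
          let u , u∈C , u∉S₁-z , u≢v = 1+∣p∣<∣q∣⇒∃∈q∉p≢ {p = S₁ - z} {q = C}
                (≤-<-trans (≤-trans (x∈p⇒∣p-x∣<∣p∣ z∈S₁) (uses (suc zero))) m<∣C∣) v
              u∉S₁ = λ u∈S₁ → u∉S₁-z (x∈p∧x≢y⇒x∈p-y u∈S₁ λ u≡z → z∉C (subst (_∈ C) u≡z u∈C))
          in  escapes-∷ S v∉S₀ (clique v u v∈C u∈C (u≢v ∘ sym)) (safe₁ u u∈C u∉S₁)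

      pairwise-safe : ∀ {ℓ} (S : Strategy G ℓ) → UsesAtMost G S m → SafeIn C S
      pairwise-safe {zero} S _ v _ _ = escapes-[] S v
      pairwise-safe {suc zero} S _ v v∈C v∉S₀ =
        let w , w∈C , w≢v = 1<∣p∣⇒∃∈p≢ 1<∣C∣ v
        in  escapes-∷ S v∉S₀ (clique v w v∈C w∈C (w≢v ∘ sym)) (escapes-[] (tail S) w)
      pairwise-safe {suc (suc ℓ)} S uses =
        safe-∷∷ S uses (pairwise-safe (tail S) (λ j → uses (suc j)))
                       (pairwise-safe (tail (tail S)) (λ j → uses (suc (suc j))))

    pairwise-¬winnable : ∀ {m} → m < ∣ C ∣ → ¬ WinnableWith G m
    pairwise-¬winnable m<∣C∣ winnable@(ℓ , S , _ , winning , uses) =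
      safe⇒¬winning S uses m<∣C∣ (pairwise-safe m<∣C∣ 1<∣C∣ S uses) winning
      where
      1<∣C∣ : 1 < ∣ C ∣
      1<∣C∣ = ≤-<-trans (winnable⇒0<hunters v winnable) m<∣C∣
        where v = proj₁ (0<∣p∣⇒nonempty {p = C} (≤-<-trans z≤n m<∣C∣))

  module _ {C : Subset n} (independent : IsIndependent G (∁ C)) where

    outside-nonadjacent : ∀ {u w} → u ∉ C → w ∉ C → ¬ Adj G u w
    outside-nonadjacent u∉C w∉C = independent _ _ (x∉p⇒x∈∁p u∉C) (x∉p⇒x∈∁p w∉C)

    cover-winnable : Nonempty C → WinnableWith G ∣ C ∣
    cover-winnable nonempty =
      2 , (λ _ → C) , (λ _ → nonempty) , unavoidable⇒winning _ unavoidable , (λ _ → ≤-refl)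
      where
      unavoidable : ∀ r → IsTrajectory G 2 r → ¬ Avoids (λ _ → C) r
      unavoidable r walk avoids = outside-nonadjacent (avoids zero) (avoids (suc zero)) (walk zero)

    next-position : ∀ {s t u w} → u ≡ s ⊎ u ∉ C → w ≡ t ⊎ w ∉ C → Adj G u w →
                    w ≡ t ⊎ (w ∉ C × Adj G w s)
    next-position _            (inj₁ w≡t) _   = inj₁ w≡t
    next-position (inj₁ refl)  (inj₂ w∉C) u~w = inj₂ (w∉C , Adj-sym u~w)
    next-position (inj₂ u∉C)   (inj₂ w∉C) u~w = contradiction u~w (outside-nonadjacent u∉C w∉C)

    module _ {x y} (x∈C : x ∈ C) (y∈C : y ∈ C) (x≢y : x ≢ y)
             (noCommon : ¬ OutsideCommonNeighbour C x y) where

      target : Fin 5 → Fin n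
      target zero                            = y
      target (suc zero)                      = y
      target (suc (suc zero))                = x
      target (suc (suc (suc zero)))          = x
      target (suc (suc (suc (suc zero))))    = y

      five-rounds : Strategy G 5
      five-rounds j = C - target j

      five-rounds-unavoidable : ∀ r → IsTrajectory G 5 r → ¬ Avoids five-rounds r
      five-rounds-unavoidable r walk avoids = finish (at (suc (suc (suc (suc zero))))) r₃-position
        where
        r₂ r₃ r₄ : Fin n
        r₂ = r (suc (suc zero))
        r₃ = r (suc (suc (suc zero)))
        r₄ = r (suc (suc (suc (suc zero))))
        at : ∀ j → r (inject₁ j) ≡ target j ⊎ r (inject₁ j) ∉ C
        at j = x∉p-y⇒x≡y⊎x∉p (avoids j)
        r₂-position : r₂ ≡ x ⊎ (r₂ ∉ C × Adj G r₂ y)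
        r₂-position =
          next-position (map₂ proj₁ (next-position (at zero) (at (suc zero)) (walk zero)))
                        (at (suc (suc zero))) (walk (suc zero))
        rule-out-x : r₃ ≡ x ⊎ (r₃ ∉ C × Adj G r₃ x) → r₃ ∉ C × Adj G r₃ x
        rule-out-x (inj₂ r₃-position) = r₃-position
        rule-out-x (inj₁ r₃≡x) with r₂-position
        ... | inj₁ r₂≡x          =
          ⊥-elim (Adj-irrefl (subst₂ (Adj G) r₂≡x r₃≡x (walk (suc (suc zero)))))
        ... | inj₂ (r₂∉C , r₂~y) =
          ⊥-elim (noCommon (r₂ , r₂∉C , subst (Adj G r₂) r₃≡x (walk (suc (suc zero))) , r₂~y))
        r₃-position : r₃ ∉ C × Adj G r₃ x
        r₃-position = rule-out-x
          (next-position (map₂ proj₁ r₂-position) (at (suc (suc (suc zero)))) (walk (suc (suc zero))))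
        finish : r₄ ≡ y ⊎ r₄ ∉ C → r₃ ∉ C × Adj G r₃ x → ⊥
        finish (inj₁ r₄≡y) (r₃∉C , r₃~x) =
          noCommon (r₃ , r₃∉C , r₃~x , subst (Adj G r₃) r₄≡y (walk (suc (suc (suc zero)))))
        finish (inj₂ r₄∉C) (r₃∉C , _) = outside-nonadjacent r₃∉C r₄∉C (walk (suc (suc (suc zero))))

      remove-one : ∀ {t u} → t ∈ C → u ∈ C → u ≢ t → Nonempty (C - t) × ∣ C - t ∣ ≤ ∣ C ∣ ∸ 1
      remove-one t∈C u∈C u≢t = (_ , x∈p∧x≢y⇒x∈p-y u∈C u≢t) , <⇒≤pred (x∈p⇒∣p-x∣<∣p∣ t∈C)

      five-rounds-legal : ∀ j → Nonempty (five-rounds j) × ∣ five-rounds j ∣ ≤ ∣ C ∣ ∸ 1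
      five-rounds-legal zero                         = remove-one y∈C x∈C x≢y
      five-rounds-legal (suc zero)                   = remove-one y∈C x∈C x≢y
      five-rounds-legal (suc (suc zero))             = remove-one x∈C y∈C (x≢y ∘ sym)
      five-rounds-legal (suc (suc (suc zero)))       = remove-one x∈C y∈C (x≢y ∘ sym)
      five-rounds-legal (suc (suc (suc (suc zero)))) = remove-one y∈C x∈C x≢y

      five-rounds-winnable : WinnableWith G (∣ C ∣ ∸ 1)
      five-rounds-winnable =
        5 , five-rounds , proj₁ ∘ five-rounds-legal ,
        unavoidable⇒winning five-rounds five-rounds-unavoidable , proj₂ ∘ five-rounds-legal

    pairwise⊎winnableWith∣C∣∸1 : PairwiseOutsideCommonNeighbours C ⊎ WinnableWith G (∣ C ∣ ∸ 1)
    pairwise⊎winnableWith∣C∣∸1 with any? (λ x → any? λ y →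
      (x ∈? C) ×-dec (y ∈? C) ×-dec ¬? (x ≟ᶠ y) ×-dec ¬? (outsideCommonNeighbour? C x y))
    ... | yes (x , y , x∈C , y∈C , x≢y , noCommon) = inj₂ (five-rounds-winnable x∈C y∈C x≢y noCommon)
    ... | no none = inj₁ λ x y x∈C y∈C x≢y →
      decidable-stable (outsideCommonNeighbour? C x y)
                       (λ noCommon → none (x , y , x∈C , y∈C , x≢y , noCommon))

  ⁅x⁆-clique : ∀ x → IsClique G ⁅ x ⁆
  ⁅x⁆-clique x u w u∈⁅x⁆ w∈⁅x⁆ u≢w =
    ⊥-elim (u≢w (trans (x∈⁅y⁆⇒x≡y x u∈⁅x⁆) (sym (x∈⁅y⁆⇒x≡y x w∈⁅x⁆))))

  maximalClique-nonempty : ∀ {C} → Fin n → IsMaximalClique G C → Nonempty C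
  maximalClique-nonempty {C} v (_ , maximal) = decidable-stable (nonempty? C) λ empty →
    empty (v , maximal ⁅ v ⁆ (⁅x⁆-clique v) (λ {u} u∈C → ⊥-elim (empty (u , u∈C))) (x∈⁅x⁆ v))

theorem4p3 : ∀ {n : ℕ} (G : Graph n) (C : Subset n) →
    1 < n → Connected G → IsMaximalClique G C → IsIndependent G (∁ C) →
    ( IsHunterNumber G ∣ C ∣ ⇔
        (∀ x y → x ∈ C → y ∈ C → x ≢ y → ∃ λ z → z ∉ C × Adj G z x × Adj G z y) )
    × ( ¬ (∀ x y → x ∈ C → y ∈ C → x ≢ y → ∃ λ z → z ∉ C × Adj G z x × Adj G z y)
        → IsHunterNumber G (∣ C ∣ ∸ 1) )
theorem4p3 {suc (suc k)} G C (s≤s (s≤s _)) _ maximalClique@(clique , _) independent =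
  mk⇔ hunters→pairwise pairwise→hunters , ¬pairwise→hunters
  where
  n≢1 : suc (suc k) ≢ 1
  n≢1 ()
  C≢∅ : Nonempty C
  C≢∅ = maximalClique-nonempty G zero maximalClique
  pairwise→hunters : PairwiseOutsideCommonNeighbours G C → IsHunterNumber G ∣ C ∣
  pairwise→hunters pairwise = isHunterNumber G n≢1 (cover-winnable G independent C≢∅)
    (λ _ → pairwise-¬winnable G clique pairwise)
  hunters→pairwise : IsHunterNumber G ∣ C ∣ → PairwiseOutsideCommonNeighbours G C
  hunters→pairwise (inj₁ (n≡1 , _)) = contradiction n≡1 n≢1
  hunters→pairwise (inj₂ (_ , _ , minimal)) with pairwise⊎winnableWith∣C∣∸1 G independent
  ... | inj₁ pairwise = pairwise
  ... | inj₂ winnable =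
    ⊥-elim (n≮n ∣ C ∣ (m≤pred[n]⇒suc[m]≤n {{>-nonZero 0<∣C∣}} (minimal _ winnable)))
    where
    0<∣C∣ : 0 < ∣ C ∣
    0<∣C∣ = x∈p⇒0<∣p∣ (proj₂ C≢∅)
  ¬pairwise→hunters : ¬ PairwiseOutsideCommonNeighbours G C → IsHunterNumber G (∣ C ∣ ∸ 1)
  ¬pairwise→hunters ¬pairwise with pairwise⊎winnableWith∣C∣∸1 G independent
  ... | inj₁ pairwise = contradiction pairwise ¬pairwise
  ... | inj₂ winnable = isHunterNumber G n≢1 winnable
    (λ m m<∣C∣∸1 → clique-¬winnable G clique (pred-cancel-< {suc m} m<∣C∣∸1))
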